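{- For each non-empty pair partition $\mathfrak{m}\in\mathcal{P}_k$, the $bt$-Weingarten function satisfies, in $\mathbb{R}[b,M][[N^{ -1}]]$, \begin{align*} \mathrm{Wg}^{(bt)}(\mathfrak{m})={}&-\frac1N\sum_{i=1}^{2k-2}\omega^{(b)}(\mathfrak{m},(i~2k-1)\cdot\mathfrak{m})\,\mathrm{Wg}^{(bt)}((i~2k-1)\cdot\mathfrak{m})+\frac MN\,\delta_{\{2k-1,2k\}\in\mathfrak{m}}\,\mathrm{Wg}^{(bt)}(\mathfrak{m}^\downarrow)\\ &+\frac1N\sum_{i=1}^{2k-2}\delta_{\{i,2k\}\in\mathfrak{m}}\,\mathrm{Wg}^{(bt)}\big([(i~2k-1)\cdot\mathfrak{m}]^\downarrow\big). \end{align*}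
   Context: $\mathcal{P}_k$ is the set of pair partitions of $\{1,\ldots,2k\}$ ($\mathcal{P}_0=\{(\,)\}$), $\mathcal{P}_\bullet=\bigsqcup_k\mathcal{P}_k$, $\mathfrak{e}_k=\{\{1,2\},\ldots,\{2k-1,2k\}\}$, $\sigma\cdot\mathfrak{m}=\{\{\sigma(a),\sigma(b)\}:\{a,b\}\in\mathfrak{m}\}$. $\delta_{\{i,j\}\in\mathfrak{m}}$ is $1$ if $\{i,j\}\in\mathfrak{m}$, else $0$; if $\{2k-1,2k\}\in\mathfrak{m}$, $\mathfrak{m}^\downarrow\in\mathcal{P}_{k-1}$ deletes that block. Weight $\omega^{(b)}(\mathfrak{m},\mathfrak{n})$ for $\mathfrak{m},\mathfrak{n}\in\mathcal{P}_k$: $0$ unless $(i~j)\cdot\mathfrak{m}=\mathfrak{n}$ for some transposition $(i~j)$; in that case form the multigraph $\Gamma(\mathfrak{m})$ on $\{1,\ldots,2k\}$ with one edge per block of $\mathfrak{e}_k$ and one per block of $\mathfrak{m}$ (a union of even cycles), charge vertices by $\{+,-\}$ so the largest vertex of each cycle is $+$ and each edge joins opposite charges, and set $\omega^{(b)}=1$ if $i,j$ have equal charge, $b$ otherwise (well defined). The $bt$-Weingarten graph $\mathcal{G}^{(bt)}$ has vertex set $\mathcal{P}_\bullet$ and for $\mathfrak{m}\in\mathcal{P}_k$: type $A$ edges $\mathfrak{m}\to(i~2k-1)\cdot\mathfrak{m}$, $1\le i\le2k-2$, of weight $\omega^{(b)}(\mathfrak{m},(i~2k-1)\cdot\mathfrak{m})$;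 a type $B$ edge $\mathfrak{m}\to\mathfrak{m}^\downarrow$ of weight $1$ if $\{2k-1,2k\}\in\mathfrak{m}$; type $C$ edges $\mathfrak{m}\to[(i~2k-1)\cdot\mathfrak{m}]^\downarrow$ of weight $1$ for each $1\le i\le 2k-2$ with $\{i,2k\}\in\mathfrak{m}$. $\mathrm{Wg}^{(bt)}(\mathfrak{m})=\sum_{\bm\rho}(-1/N)^{\ell_A(\bm\rho)}(M/N)^{\ell_B(\bm\rho)}(1/N)^{\ell_C(\bm\rho)}w(\bm\rho)$, summed over directed paths $\bm\rho$ in $\mathcal{G}^{(bt)}$ from $\mathfrak{m}$ to the empty pair partition, with $\ell_K$ the number of type-$K$ edges and $w$ the product of edge weights. -}

module Defs where

open import Data.Nat as ℕ using (ℕ; zero; suc; _<_)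
open import Data.Nat.Properties as ℕP using ()
open import Data.Integer as ℤ using (ℤ; +_; -_)
open import Data.Fin as Fin using (Fin; toℕ; fromℕ; inject₁; lower₁)
open import Data.Fin.Properties as FinP using (toℕ-injective; toℕ-fromℕ; toℕ-inject₁; toℕ-lower₁)
open import Data.Bool using (Bool; true; false; if_then_else_; not; _∧_)
open import Data.List as List using (List; []; _∷_; _++_; map; concatMap; foldr)
open import Data.Empty using (⊥-elim)
open import Relation.Nullary using (¬_; Dec; yes; no)
open import Relation.Binary.PropositionalEquality

-- Points.  P_k is built on the set {1,…,2k}, here Fin (double k)
-- (0-indexed: the point i of the paper is the element with toℕ = i-1).

double : ℕ → ℕ
double zero    = zero
double (suc k) = suc (suc (double k))

-- Pair partitions of {1,…,2k}: encoded by the partner map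
-- (a fixed-point-free involution); {a,b} ∈ m  iff  partner a ≡ b.

record PP (k : ℕ) : Set where
  constructor pp
  field
    partner : Fin (double k) → Fin (double k)
    invol   : ∀ x → partner (partner x) ≡ x
    fpf     : ∀ x → partner x ≢ x
open PP public

emptyPP : PP 0
emptyPP = pp (λ ()) (λ ()) (λ ())

swap : ∀ {n} → Fin n → Fin n → Fin n → Fin n
swap i j x with x Fin.≟ i
... | yes _ = j
... | no _ with x Fin.≟ j
...   | yes _ = i
...   | no _  = x

swap-invol : ∀ {n} (i j x : Fin n) → swap i j (swap i j x) ≡ x
swap-invol i j x with x Fin.≟ i
swap-invol i j x | yes x≡i with j Fin.≟ i
... | yes j≡i = trans j≡i (sym x≡i)
... | no  j≢i with j Fin.≟ j
...   | yes _ = sym x≡i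
...   | no j≢j = ⊥-elim (j≢j refl)
swap-invol i j x | no x≢i with x Fin.≟ j
swap-invol i j x | no x≢i | yes x≡j with i Fin.≟ i
... | yes _ = sym x≡j
... | no i≢i = ⊥-elim (i≢i refl)
swap-invol i j x | no x≢i | no x≢j with x Fin.≟ i
... | yes x≡i = ⊥-elim (x≢i x≡i)
... | no _ with x Fin.≟ j
...   | yes x≡j = ⊥-elim (x≢j x≡j)
...   | no _ = refl

act : ∀ {k} → Fin (double k) → Fin (double k) → PP k → PP k
act {k} i j m = pp q qq qf
  where
  τ = swap i j
  q : Fin (double k) → Fin (double k)
  q x = τ (partner m (τ x))
  qq : ∀ x → q (q x) ≡ x
  qq x = begin
      τ (partner m (τ (τ (partner m (τ x)))))
    ≡⟨ cong (λ y → τ (partner m y)) (swap-invol i j _) ⟩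
      τ (partner m (partner m (τ x)))
    ≡⟨ cong τ (invol m (τ x)) ⟩
      τ (τ x)
    ≡⟨ swap-invol i j x ⟩
      x ∎
    where open ≡-Reasoning
  qf : ∀ x → q x ≢ x
  qf x e = fpf m (τ x) (trans (sym (swap-invol i j _)) (cong τ e))

pt2k-1 : ∀ j → Fin (double (suc j))
pt2k-1 j = inject₁ (fromℕ (double j))

pt2k : ∀ j → Fin (double (suc j))
pt2k j = fromℕ (suc (double j))

ι : ∀ {j} → Fin (double j) → Fin (double (suc j))
ι x = inject₁ (inject₁ x)

toℕ-ι : ∀ {j} (x : Fin (double j)) → toℕ (ι x) ≡ toℕ x
toℕ-ι x = trans (toℕ-inject₁ (inject₁ x)) (toℕ-inject₁ x)

-- m↓ : delete the block {2k-1,2k} (requires it to be a block of m).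

private
  lower2 : ∀ {D} (y : Fin (suc (suc D))) → toℕ y ≢ D → toℕ y ≢ suc D → Fin D
  lower2 {D} y n1 n2 =
    lower₁ (lower₁ y (λ e → n2 (sym e)))
           (λ e → n1 (sym (trans e (toℕ-lower₁ y (λ e → n2 (sym e))))))

  toℕ-lower2 : ∀ {D} (y : Fin (suc (suc D))) (n1 : toℕ y ≢ D) (n2 : toℕ y ≢ suc D) →
               toℕ (lower2 y n1 n2) ≡ toℕ y
  toℕ-lower2 y n1 n2 = trans (toℕ-lower₁ _ _) (toℕ-lower₁ y _)

down : ∀ {j} (m : PP (suc j)) → partner m (pt2k-1 j) ≡ pt2k j → PP j
down {j} m e = pp q qq qf
  where
  D = double j
  a = pt2k-1 j
  z = pt2k j
  ta : toℕ a ≡ D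
  ta = trans (toℕ-inject₁ (fromℕ D)) (toℕ-fromℕ D)
  tz : toℕ z ≡ suc D
  tz = toℕ-fromℕ (suc D)
  pz : partner m z ≡ a
  pz = trans (cong (partner m) (sym e)) (invol m a)
  tι<D : ∀ x → toℕ (ι {j} x) < D
  tι<D x = subst (_< D) (sym (toℕ-ι x)) (FinP.toℕ<n x)
  n1 : ∀ x → toℕ (partner m (ι x)) ≢ D
  n1 x h = ℕP.<-asym (ℕP.n<1+n D) (subst (_< D) ιz (tι<D x))
    where
    pa : partner m (ι x) ≡ a
    pa = toℕ-injective (trans h (sym ta))
    ιz : toℕ (ι {j} x) ≡ suc D
    ιz = trans (cong toℕ (trans (sym (invol m (ι x))) (trans (cong (partner m) pa) e))) tz
  n2 : ∀ x → toℕ (partner m (ι x)) ≢ suc D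
  n2 x h = ℕP.<-irrefl ιa (tι<D x)
    where
    pzz : partner m (ι x) ≡ z
    pzz = toℕ-injective (trans h (sym tz))
    ιa : toℕ (ι {j} x) ≡ D
    ιa = trans (cong toℕ (trans (sym (invol m (ι x))) (trans (cong (partner m) pzz) pz))) ta
  q : Fin D → Fin D
  q x = lower2 (partner m (ι x)) (n1 x) (n2 x)
  ιq : ∀ x → ι (q x) ≡ partner m (ι x)
  ιq x = toℕ-injective (trans (toℕ-ι (q x)) (toℕ-lower2 _ (n1 x) (n2 x)))
  qq : ∀ x → q (q x) ≡ x
  qq x = toℕ-injective (trans (toℕ-lower2 _ (n1 (q x)) (n2 (q x)))
           (trans (cong (λ y → toℕ (partner m y)) (ιq x))
             (trans (cong toℕ (invol m (ι x))) (toℕ-ι x))))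
  qf : ∀ x → q x ≢ x
  qf x h = fpf m (ι x) (trans (sym (ιq x)) (cong ι h))

swap-r : ∀ {n} (i j : Fin n) → swap i j j ≡ i
swap-r i j with j Fin.≟ i
... | yes j≡i = j≡i
... | no _ with j Fin.≟ j
...   | yes _ = refl
...   | no j≢j = ⊥-elim (j≢j refl)

swap-l : ∀ {n} (i j : Fin n) → swap i j i ≡ j
swap-l i j with i Fin.≟ i
... | yes _ = refl
... | no i≢i = ⊥-elim (i≢i refl)

swap-other : ∀ {n} (i j y : Fin n) → y ≢ i → y ≢ j → swap i j y ≡ y
swap-other i j y yi yj with y Fin.≟ i
... | yes e = ⊥-elim (yi e)
... | no _ with y Fin.≟ j
...   | yes e = ⊥-elim (yj e)
...   | no _ = refl

act-C : ∀ {j} (m : PP (suc j)) (x : Fin (double j)) → partner m (ι x) ≡ pt2k j →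
        partner (act (ι x) (pt2k-1 j) m) (pt2k-1 j) ≡ pt2k j
act-C {j} m x e =
  trans (cong (swap (ι x) (pt2k-1 j)) (trans (cong (partner m) (swap-r (ι x) (pt2k-1 j))) e))
        (swap-other (ι x) (pt2k-1 j) (pt2k j) zι za)
  where
  D = double j
  tz : toℕ (pt2k j) ≡ suc D
  tz = toℕ-fromℕ (suc D)
  zι : pt2k j ≢ ι x
  zι h = ℕP.<-asym (ℕP.n<1+n D)
           (subst (_< D) (trans (sym (cong toℕ h)) tz) (subst (_< D) (sym (toℕ-ι x)) (FinP.toℕ<n x)))
  za : pt2k j ≢ pt2k-1 j
  za h = ℕP.1+n≢n (trans (sym tz) (trans (cong toℕ h) (trans (toℕ-inject₁ (fromℕ D)) (toℕ-fromℕ D))))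

-- The graph Γ(m) and the charges.  e-edges pair 2a-1 with 2a, i.e.
-- (0-indexed) 2a with 2a+1.

epair : ∀ k → Fin (double k) → Fin (double k)
epair (suc k) Fin.zero             = Fin.suc Fin.zero
epair (suc k) (Fin.suc Fin.zero)    = Fin.zero
epair (suc k) (Fin.suc (Fin.suc x)) = Fin.suc (Fin.suc (epair k x))

orbit : ∀ {k} → PP k → Fin (double k) → ℕ → Bool → List (Fin (double k))
orbit m v zero    _     = []
orbit {k} m v (suc t) true  = v ∷ orbit m (epair k v) t false
orbit m v (suc t) false = v ∷ orbit m (partner m v) t true

maxℕ : List ℕ → ℕ
maxℕ = foldr ℕ._⊔_ 0

firstIndex : ℕ → List ℕ → ℕ
firstIndex n []       = 0
firstIndex n (x ∷ xs) = if x ℕ.≡ᵇ n then 0 else suc (firstIndex n xs)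

isEven : ℕ → Bool
isEven zero    = true
isEven (suc n) = not (isEven n)

-- charge of v in Γ(m): true = '+', false = '-'.  The cycle through v has
-- at most 2k vertices, so the first 2k vertices of the walk cover it; the
-- charge is + iff the distance from v to the largest vertex of its cycle
-- is even (charges alternate along edges, and the largest vertex is +).
charge : ∀ {k} → PP k → Fin (double k) → Bool
charge {k} m v = isEven (firstIndex (maxℕ vs) vs)
  where vs = List.map toℕ (orbit m v (double k) true)

sameCharge : ∀ {k} → PP k → Fin (double k) → Fin (double k) → Bool
sameCharge m i j with charge m i | charge m j
... | true  | true  = true
... | false | false = true
... | _     | _     = false

-- ω^(b)(m,(i j)·m) is 1 if sameCharge m i j, and b otherwise.

-- Formal power series in ℤ[b,M][[N⁻¹]] (⊆ ℝ[b,M][[N⁻¹]]), given by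
-- coefficients:  s n p q = coefficient of N^(-n) b^p M^q.

Series : Set
Series = ℕ → ℕ → ℕ → ℤ

_≈S_ : Series → Series → Set
s ≈S t = ∀ n p q → s n p q ≡ t n p q

0S : Series
0S _ _ _ = + 0

_⊕_ : Series → Series → Series
(s ⊕ t) n p q = s n p q ℤ.+ t n p q
infixl 6 _⊕_

⊖_ : Series → Series
(⊖ s) n p q = - s n p q

invN : Series → Series
invN s zero    p q = + 0
invN s (suc n) p q = s n p q

mulB : Series → Series
mulB s n zero    q = + 0
mulB s n (suc p) q = s n p q

mulM : Series → Series
mulM s n p zero    = + 0
mulM s n p (suc q) = s n p q

ΣS : ∀ {A : Set} → List A → (A → Series) → Series
ΣS xs f = foldr (λ x acc → f x ⊕ acc) 0S xs

ωmul : Bool → Series → Series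
ωmul true  s = s
ωmul false s = mulB s

-- The bt-Weingarten graph.  A path is recorded by the list of its edges'
-- types (with, for type A, whether the weight is 1 (true) or b (false)).

data Step : Set where
  A : Bool → Step
  B : Step
  C : Step

-- All directed paths of length n from m to the empty pair partition
-- (one list entry per path; edges out of m ∈ P_{j+1} are enumerated:
-- type A for i = 1…2k-2, type B, type C for i = 1…2k-2).
walks : ℕ → ∀ {k} → PP k → List (List Step)
walks zero    {zero}  m = [] ∷ []
walks zero    {suc k} m = []
walks (suc n) {zero}  m = []
walks (suc n) {suc j} m = Apart ++ Bpart ++ Cpart
  where
  a = pt2k-1 j
  z = pt2k j
  Apart = concatMap (λ x → map (A (sameCharge m (ι x) a) ∷_) (walks n (act (ι x) a m)))
                    (List.allFin (double j))
  Bpart : List (List Step)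
  Bpart with partner m a Fin.≟ z
  ... | yes e = map (B ∷_) (walks n (down m e))
  ... | no _  = []
  Cedge : Fin (double j) → List (List Step)
  Cedge x with partner m (ι x) Fin.≟ z
  ... | yes e = map (C ∷_) (walks n (down (act (ι x) a m) (act-C m x e)))
  ... | no _  = []
  Cpart = concatMap Cedge (List.allFin (double j))

count : (Step → Bool) → List Step → ℕ
count f [] = 0
count f (s ∷ ss) = if f s then suc (count f ss) else count f ss

isA : Step → Bool
isA (A _) = true
isA _     = false

isAb : Step → Bool
isAb (A w) = not w
isAb _     = false

isB : Step → Bool
isB B = true
isB _ = false

signℤ : ℕ → ℤ
signℤ zero    = + 1
signℤ (suc n) = - signℤ n

monoCoeff : List Step → ℕ → ℕ → ℤ
monoCoeff ρ p q =
  if (count isAb ρ ℕ.≡ᵇ p) ∧ (count isB ρ ℕ.≡ᵇ q) then signℤ (count isA ρ) else + 0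

sumℤ : List ℤ → ℤ
sumℤ = foldr ℤ._+_ (+ 0)

-- Wg^(bt)(m) = Σ_ρ (-1/N)^{ℓ_A} (M/N)^{ℓ_B} (1/N)^{ℓ_C} w(ρ); every edge
-- carries one factor N⁻¹, so the N^(-n) coefficient collects paths of length n.
Wg : ∀ {k} → PP k → Series
Wg m n p q = sumℤ (List.map (λ ρ → monoCoeff ρ p q) (walks n m))

termA : ∀ {j} → PP (suc j) → Fin (double j) → Series
termA {j} m x = ωmul (sameCharge m (ι x) (pt2k-1 j)) (Wg (act (ι x) (pt2k-1 j) m))

termB : ∀ {j} → PP (suc j) → Series
termB {j} m with partner m (pt2k-1 j) Fin.≟ pt2k j
... | yes e = Wg (down m e)
... | no _  = 0S

termC : ∀ {j} → PP (suc j) → Fin (double j) → Series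
termC {j} m x with partner m (ι x) Fin.≟ pt2k j
... | yes e = Wg (down (act (ι x) (pt2k-1 j) m) (act-C m x e))
... | no _  = 0S

-- Every path from a nonempty m to the empty pair partition starts with exactly one edge out
-- of m.  Grouping the paths of length n + 1 by that edge, a path through an A, B or C edge
-- contributes the monomial of its tail multiplied by −ω, by M or by 1 respectively, and the
-- extra factor N⁻¹ carried by every edge accounts for the shift in length.
module Submission where

open import Defs
open import Data.Bool using (true; false; if_then_else_; _∧_)
open import Data.Bool.Properties using (if-float; ∧-zeroʳ)
open import Data.Fin as Fin using (Fin)
open import Data.Integer using (ℤ; +_; -_; _+_)
open import Data.Integer.Properties using (+-identityˡ; +-assoc; neg-distrib-+)
open import Data.List using (List; []; _∷_; _++_; map; concatMap; allFin)
open import Data.List.Properties using (map-++; map-∘; map-cong)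
open import Data.Nat using (ℕ; zero; suc; _≡ᵇ_)
open import Relation.Nullary using (yes; no)
open import Relation.Binary.PropositionalEquality
open ≡-Reasoning

sumℤ-++ : ∀ xs ys → sumℤ (xs ++ ys) ≡ sumℤ xs + sumℤ ys
sumℤ-++ []       ys = sym (+-identityˡ (sumℤ ys))
sumℤ-++ (x ∷ xs) ys = trans (cong (_+_ x) (sumℤ-++ xs ys)) (sym (+-assoc x (sumℤ xs) (sumℤ ys)))

sumℤ-map-neg : ∀ {X : Set} (f : X → ℤ) xs → sumℤ (map (λ x → - f x) xs) ≡ - sumℤ (map f xs)
sumℤ-map-neg f []       = refl
sumℤ-map-neg f (x ∷ xs) =
  trans (cong (_+_ (- f x)) (sumℤ-map-neg f xs)) (sym (neg-distrib-+ (f x) (sumℤ (map f xs))))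

sumℤ-map-0 : ∀ {X : Set} (xs : List X) → sumℤ (map (λ _ → + 0) xs) ≡ + 0
sumℤ-map-0 []       = refl
sumℤ-map-0 (x ∷ xs) = cong (_+_ (+ 0)) (sumℤ-map-0 xs)

ΣS-⊖ : ∀ {X : Set} (xs : List X) (t : X → Series) → ΣS xs (λ x → ⊖ t x) ≈S (⊖ ΣS xs t)
ΣS-⊖ []       t n p q = refl
ΣS-⊖ (x ∷ xs) t n p q =
  trans (cong (_+_ (- t x n p q)) (ΣS-⊖ xs t n p q)) (sym (neg-distrib-+ (t x n p q) _))

pathSum : List (List Step) → ℕ → ℕ → ℤ
pathSum ρs p q = sumℤ (map (λ ρ → monoCoeff ρ p q) ρs)

pathSum-++ : ∀ ρs σs p q → pathSum (ρs ++ σs) p q ≡ pathSum ρs p q + pathSum σs p q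
pathSum-++ ρs σs p q =
  trans (cong sumℤ (map-++ _ ρs σs))
        (sumℤ-++ (map (λ ρ → monoCoeff ρ p q) ρs) (map (λ ρ → monoCoeff ρ p q) σs))

pathSum-concatMap : ∀ {X : Set} (f : X → List (List Step)) (t : X → Series) xs n p q →
                    (∀ x → pathSum (f x) p q ≡ t x n p q) →
                    pathSum (concatMap f xs) p q ≡ ΣS xs t n p q
pathSum-concatMap f t []       n p q eq = refl
pathSum-concatMap f t (x ∷ xs) n p q eq =
  trans (pathSum-++ (f x) (concatMap f xs) p q)
        (cong₂ _+_ (eq x) (pathSum-concatMap f t xs n p q eq))

pathSum-prepend : ∀ s ρs p q →
                  pathSum (map (s ∷_) ρs) p q ≡ sumℤ (map (λ ρ → monoCoeff (s ∷ ρ) p q) ρs)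
pathSum-prepend s ρs p q = cong sumℤ (sym (map-∘ ρs))

pathSum-prepend-neg : ∀ s ρs p′ p q → (∀ ρ → monoCoeff (s ∷ ρ) p′ q ≡ - monoCoeff ρ p q) →
                      pathSum (map (s ∷_) ρs) p′ q ≡ - pathSum ρs p q
pathSum-prepend-neg s ρs p′ p q eq = begin
  pathSum (map (s ∷_) ρs) p′ q                 ≡⟨ pathSum-prepend s ρs p′ q ⟩
  sumℤ (map (λ ρ → monoCoeff (s ∷ ρ) p′ q) ρs) ≡⟨ cong sumℤ (map-cong eq ρs) ⟩
  sumℤ (map (λ ρ → - monoCoeff ρ p q) ρs)      ≡⟨ sumℤ-map-neg (λ ρ → monoCoeff ρ p q) ρs ⟩
  - pathSum ρs p q                             ∎

pathSum-prepend-0 : ∀ s ρs p q → (∀ ρ → monoCoeff (s ∷ ρ) p q ≡ + 0) →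
                    pathSum (map (s ∷_) ρs) p q ≡ + 0
pathSum-prepend-0 s ρs p q eq = begin
  pathSum (map (s ∷_) ρs) p q                 ≡⟨ pathSum-prepend s ρs p q ⟩
  sumℤ (map (λ ρ → monoCoeff (s ∷ ρ) p q) ρs) ≡⟨ cong sumℤ (map-cong eq ρs) ⟩
  sumℤ (map (λ _ → + 0) ρs)                   ≡⟨ sumℤ-map-0 ρs ⟩
  + 0                                         ∎

monoCoeff-A-1 : ∀ ρ p q → monoCoeff (A true ∷ ρ) p q ≡ - monoCoeff ρ p q
monoCoeff-A-1 ρ p q = sym (if-float -_ ((count isAb ρ ≡ᵇ p) ∧ (count isB ρ ≡ᵇ q)))

monoCoeff-A-b : ∀ ρ p q → monoCoeff (A false ∷ ρ) (suc p) q ≡ - monoCoeff ρ p q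
monoCoeff-A-b ρ p q = sym (if-float -_ ((count isAb ρ ≡ᵇ p) ∧ (count isB ρ ≡ᵇ q)))

monoCoeff-B-M⁰ : ∀ ρ p → monoCoeff (B ∷ ρ) p zero ≡ + 0
monoCoeff-B-M⁰ ρ p = cong (if_then signℤ (count isA ρ) else + 0) (∧-zeroʳ (count isAb ρ ≡ᵇ p))

pathSum-A : ∀ w {k} (m′ : PP k) n p q →
            pathSum (map (A w ∷_) (walks n m′)) p q ≡ (⊖ ωmul w (Wg m′)) n p q
pathSum-A true  m′ n p       q =
  pathSum-prepend-neg (A true) (walks n m′) p p q (λ ρ → monoCoeff-A-1 ρ p q)
pathSum-A false m′ n zero    q =
  pathSum-prepend-0 (A false) (walks n m′) zero q (λ _ → refl)
pathSum-A false m′ n (suc p) q =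
  pathSum-prepend-neg (A false) (walks n m′) (suc p) p q (λ ρ → monoCoeff-A-b ρ p q)

pathSum-B : ∀ {k} (m′ : PP k) n p q →
            pathSum (map (B ∷_) (walks n m′)) p q ≡ mulM (invN (Wg m′)) (suc n) p q
pathSum-B m′ n p zero    = pathSum-prepend-0 B (walks n m′) p zero (λ ρ → monoCoeff-B-M⁰ ρ p)
pathSum-B m′ n p (suc q) = pathSum-prepend B (walks n m′) p (suc q)

pathSum-C : ∀ ρs p q → pathSum (map (C ∷_) ρs) p q ≡ pathSum ρs p q
pathSum-C ρs p q = pathSum-prepend C ρs p q

mulM-invN-0S : ∀ n p q → mulM (invN 0S) n p q ≡ + 0
mulM-invN-0S n       p zero    = refl
mulM-invN-0S zero    p (suc q) = refl
mulM-invN-0S (suc n) p (suc q) = refl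

Wg-suc : ∀ {j} (m : PP (suc j)) n p q →
         Wg m (suc n) p q ≡ ΣS (allFin (double j)) (λ x → ⊖ termA m x) n p q
                            + (mulM (invN (termB m)) (suc n) p q + ΣS (allFin (double j)) (termC m) n p q)
Wg-suc {j} m n p q = begin
  Wg m (suc n) p q
    ≡⟨ cong (λ ρs → pathSum ρs p q) walks-suc ⟩
  pathSum (aedges ++ bedges ++ cedges) p q
    ≡⟨ pathSum-++ aedges (bedges ++ cedges) p q ⟩
  pathSum aedges p q + pathSum (bedges ++ cedges) p q
    ≡⟨ cong (_+_ (pathSum aedges p q)) (pathSum-++ bedges cedges p q) ⟩
  pathSum aedges p q + (pathSum bedges p q + pathSum cedges p q)
    ≡⟨ cong₂ _+_ aedges-pathSum (cong₂ _+_ bedges-pathSum cedges-pathSum) ⟩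
  ΣS xs (λ x → ⊖ termA m x) n p q + (mulM (invN (termB m)) (suc n) p q + ΣS xs (termC m) n p q)
    ∎
  where
  xs : List (Fin (double j))
  xs = allFin (double j)
  a : Fin (double (suc j))
  a = pt2k-1 j
  aedge : Fin (double j) → List (List Step)
  aedge x = map (A (sameCharge m (ι x) a) ∷_) (walks n (act (ι x) a m))
  aedges : List (List Step)
  aedges = concatMap aedge xs
  -- The B- and C-edge lists are with-functions local to walks, so they cannot be named;
  -- these two metas are solved by unification in walks-suc.
  bedges : List (List Step)
  bedges = _
  cedge : Fin (double j) → List (List Step)
  cedge = _
  cedges : List (List Step)
  cedges = concatMap cedge xs
  walks-suc : walks (suc n) m ≡ aedges ++ bedges ++ cedges
  walks-suc = refl
  aedges-pathSum : pathSum aedges p q ≡ ΣS xs (λ x → ⊖ termA m x) n p q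
  aedges-pathSum = pathSum-concatMap aedge (λ x → ⊖ termA m x) xs n p q
                     (λ x → pathSum-A (sameCharge m (ι x) a) (act (ι x) a m) n p q)
  bedges-pathSum : pathSum bedges p q ≡ mulM (invN (termB m)) (suc n) p q
  bedges-pathSum with partner m a Fin.≟ pt2k j
  ... | yes e = pathSum-B (down m e) n p q
  ... | no _  = sym (mulM-invN-0S (suc n) p q)
  cedge-pathSum : ∀ x → pathSum (cedge x) p q ≡ termC m x n p q
  cedge-pathSum x with partner m (ι x) Fin.≟ pt2k j
  ... | yes e = pathSum-C (walks n (down (act (ι x) a m) (act-C m x e))) p q
  ... | no _  = refl
  cedges-pathSum : pathSum cedges p q ≡ ΣS xs (termC m) n p q
  cedges-pathSum = pathSum-concatMap cedge (termC m) xs n p q cedge-pathSum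

proposition4p13 : ∀ {j : ℕ} (m : PP (suc j)) →
    Wg m ≈S ((⊖ invN (ΣS (allFin (double j)) (termA m)))
    ⊕ mulM (invN (termB m))
    ⊕ invN (ΣS (allFin (double j)) (termC m)))
-- walks 0 m is empty, and every term on the right carries a factor N⁻¹.
proposition4p13 m zero p zero    = refl
proposition4p13 m zero p (suc q) = refl
proposition4p13 {j} m (suc n) p q = begin
  Wg m (suc n) p q                                 ≡⟨ Wg-suc m n p q ⟩
  ΣS xs (λ x → ⊖ termA m x) n p q + (tB + tC)      ≡⟨ cong (_+ (tB + tC)) (ΣS-⊖ xs (termA m) n p q) ⟩
  - ΣS xs (termA m) n p q + (tB + tC)              ≡⟨ sym (+-assoc (- ΣS xs (termA m) n p q) tB tC) ⟩
  - ΣS xs (termA m) n p q + tB + tC                ∎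
  where
  xs : List (Fin (double j))
  xs = allFin (double j)
  tB tC : ℤ
  tB = mulM (invN (termB m)) (suc n) p q
  tC = ΣS xs (termC m) n p q
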